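{- In the $F_2$ Black Hole Zeckendorf game, the position $(a)$ (with $a\in\mathbb{Z}_{\ge0}$) is a $P$ position if $a\equiv 0,1\pmod 4$ and an $N$ position if $a\equiv 2,3\pmod 4$. In the Empty Board $F_2$ Black Hole Zeckendorf game with $n\in\mathbb{Z}^{+}$ pieces, Player $1$ wins for all $n\equiv 1,2\pmod 4$ and Player $2$ wins for all $n\equiv 0,3\pmod 4$.
   Context: The $F_2$ Black Hole Zeckendorf game: a position is a nonnegative integer $(a)$, the number of pieces in the single column $F_1$ (weight $1$). Two players alternate moves; the only move is, if $a\ge 2$, to merge two pieces, which would create a piece in column $F_2$ (the "black hole") and is therefore removed, giving $(a-2)$. The last player to move wins. A position is a $P$ position if the player to move from it loses under optimal play, an $N$ position if the player to move wins; positions with no move are $P$ positions. The Empty Board $F_2$ Black Hole Zeckendorf game with $n$ pieces: Player $1$ and Player $2$ alternate (Player $1$ first) placing one piece in column $F_1$ until $n$ pieces are placed, giving $(n)$; then the decomposition phase is played from $(n)$, the player who did not place the last piece moving first, and the last player to move in the whole game wins (so the player who placed the last piece wins exactly when $(n)$ is a $P$ position). -}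

module Defs where

open import Data.Nat using (ℕ; zero; suc; _+_)
open import Data.Nat.DivMod using (_%_)
open import Data.Empty using (⊥)
open import Data.Sum using (_⊎_)
open import Data.Product using (∃; _×_)
open import Relation.Binary.PropositionalEquality using (_≡_)
open import Relation.Nullary using (¬_)

-- F₂ Black Hole Zeckendorf game: position (a) = a pieces in column F₁.
-- The only move: merge two pieces (removed into the black hole), a ↦ a - 2.
Move : ℕ → ℕ → Set
Move a b = a ≡ b + 2

-- Normal play: P = player to move loses, N = player to move wins.
-- Defined inductively (the game is finite since each move decreases a).
mutual
  data IsN (a : ℕ) : Set where
    win : (b : ℕ) → Move a b → IsP b → IsN a

  data IsP (a : ℕ) : Set where
    lose : ((b : ℕ) → Move a b → IsN b) → IsP a

-- Empty Board game with n pieces: players alternate placing one piece,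
-- Player 1 first, so Player 1 places the last piece iff n is odd.
data Player : Set where
  player1 player2 : Player

lastPlacer : ℕ → Player
lastPlacer zero = player2
lastPlacer (suc zero) = player1
lastPlacer (suc (suc n)) = lastPlacer n

other : Player → Player
other player1 = player2
other player2 = player1

-- The player who placed the last piece wins exactly when (n) is a P position;
-- otherwise (n is an N position) the other player wins.
Wins : Player → ℕ → Set
Wins p n = (lastPlacer n ≡ p × IsP n) ⊎ (other (lastPlacer n) ≡ p × IsN n)

{-# OPTIONS --safe #-}
module Submission where

-- From a ≥ 2 there is exactly one move, to a − 2, and from 0 and 1
-- none, so along each parity class the outcome alternates P, N, P, … starting
-- with P at 0 and 1; hence (a) is P iff a ≡ 0, 1 (mod 4). On the empty board,
-- both this outcome and the parity of n (which decides who placed the last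
-- piece) are 4-periodic, so the winner is read off from n = 0, 1, 2, 3.

open import Defs
open import Data.Nat using (ℕ; suc; _+_; _<_; z<s; _%_)
open import Data.Nat.Properties using (+-comm; +-cancelʳ-≡; m+n≮n; n<1+n)
open import Data.Product using (_×_; _,_)
open import Data.Sum using (_⊎_; inj₁; inj₂)
open import Function using (_∘_)
open import Relation.Binary.PropositionalEquality using (_≡_; refl; sym; trans; subst)
open import Relation.Nullary using (contradiction)

private
  variable
    a b n : ℕ
    p : Player

Move-unique : Move (2 + a) b → b ≡ a
Move-unique {a} {b} m = +-cancelʳ-≡ 2 b a (trans (sym m) (+-comm 2 a))

IsP-<2 : a < 2 → IsP a
IsP-<2 a<2 = lose λ b m → contradiction (subst (_< 2) m a<2) (m+n≮n b 2)

IsN-2+ : IsP a → IsN (2 + a)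
IsN-2+ {a} = win a (+-comm 2 a)

IsP-2+ : IsN a → IsP (2 + a)
IsP-2+ x = lose λ b m → subst IsN (sym (Move-unique m)) x

IsP-4+ : IsP a → IsP (4 + a)
IsP-4+ = IsP-2+ ∘ IsN-2+

IsN-4+ : IsN a → IsN (4 + a)
IsN-4+ = IsN-2+ ∘ IsP-2+

-- (4 + a) % 4 reduces to a % 4 by computation, so the hypothesis is passed
-- unchanged to the recursive call here and in the three lemmas below.
IsP-mod4 : ∀ a → a % 4 ≡ 0 ⊎ a % 4 ≡ 1 → IsP a
IsP-mod4 0 _ = IsP-<2 z<s
IsP-mod4 1 _ = IsP-<2 (n<1+n 1)
IsP-mod4 2 (inj₁ ())
IsP-mod4 2 (inj₂ ())
IsP-mod4 3 (inj₁ ())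
IsP-mod4 3 (inj₂ ())
IsP-mod4 (suc (suc (suc (suc a)))) h = IsP-4+ (IsP-mod4 a h)

IsN-mod4 : ∀ a → a % 4 ≡ 2 ⊎ a % 4 ≡ 3 → IsN a
IsN-mod4 0 (inj₁ ())
IsN-mod4 0 (inj₂ ())
IsN-mod4 1 (inj₁ ())
IsN-mod4 1 (inj₂ ())
IsN-mod4 2 _ = IsN-2+ (IsP-mod4 0 (inj₁ refl))
IsN-mod4 3 _ = IsN-2+ (IsP-mod4 1 (inj₂ refl))
IsN-mod4 (suc (suc (suc (suc a)))) h = IsN-4+ (IsN-mod4 a h)

Wins-4+ : Wins p n → Wins p (4 + n)
Wins-4+ (inj₁ (placedLast , x)) = inj₁ (placedLast , IsP-4+ x)
Wins-4+ (inj₂ (placedLast , x)) = inj₂ (placedLast , IsN-4+ x)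

player1-wins-mod4 : ∀ n → n % 4 ≡ 1 ⊎ n % 4 ≡ 2 → Wins player1 n
player1-wins-mod4 0 (inj₁ ())
player1-wins-mod4 0 (inj₂ ())
player1-wins-mod4 1 _ = inj₁ (refl , IsP-mod4 1 (inj₂ refl))
player1-wins-mod4 2 _ = inj₂ (refl , IsN-mod4 2 (inj₁ refl))
player1-wins-mod4 3 (inj₁ ())
player1-wins-mod4 3 (inj₂ ())
player1-wins-mod4 (suc (suc (suc (suc n)))) h = Wins-4+ (player1-wins-mod4 n h)

player2-wins-mod4 : ∀ n → n % 4 ≡ 0 ⊎ n % 4 ≡ 3 → Wins player2 n
player2-wins-mod4 0 _ = inj₁ (refl , IsP-mod4 0 (inj₁ refl))
player2-wins-mod4 1 (inj₁ ())
player2-wins-mod4 1 (inj₂ ())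
player2-wins-mod4 2 (inj₁ ())
player2-wins-mod4 2 (inj₂ ())
player2-wins-mod4 3 _ = inj₂ (refl , IsN-mod4 3 (inj₂ refl))
player2-wins-mod4 (suc (suc (suc (suc n)))) h = Wins-4+ (player2-wins-mod4 n h)

theorem3p1 :
    ((a : ℕ) → (a % 4 ≡ 0 ⊎ a % 4 ≡ 1) → IsP a)
    × ((a : ℕ) → (a % 4 ≡ 2 ⊎ a % 4 ≡ 3) → IsN a)
    × ((n : ℕ) → (suc n % 4 ≡ 1 ⊎ suc n % 4 ≡ 2) → Wins player1 (suc n))
    × ((n : ℕ) → (suc n % 4 ≡ 0 ⊎ suc n % 4 ≡ 3) → Wins player2 (suc n))
theorem3p1 =
  IsP-mod4 , IsN-mod4 , player1-wins-mod4 ∘ suc , player2-wins-mod4 ∘ suc
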